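{- Let $E$ be the elliptic curve over $\mathbb{Q}$ given by $y^2=x^3+D(ax+b)^2$, where $a,b\in\mathbb{Q}$, $D$ is a fundamental discriminant (the value $D=1$ being allowed), $b\neq 0$ and $4Da^3-27b\neq 0$. The rational points of $E$ of order dividing $3$ are the following: (1) If $D=1$: the point at infinity $O$ and the points $(0,\pm b)$. (2) If $D=-3$ and $2(9b+4a^3)=t^3$ for some nonzero $t\in\mathbb{Q}$: the point $O$ and the points $P\in E(\mathbb{Q})$ with $$x(P)=\frac{t^2}{3}+\frac{3}{t^2}\Big(4ab+\frac{16}{9}a^4\Big)+\frac{4a^2}{3}.$$ (3) In all other cases: only the point $O$.
   Context: A fundamental discriminant is $1$ or the discriminant of a quadratic field. $O$ denotes the point at infinity (the identity of $E$). -}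

module Defs where

open import Data.Nat as ℕ using (ℕ)
open import Data.Nat.Divisibility as ℕD using ()
open import Data.Integer as ℤ using (ℤ; ∣_∣)
open import Data.Rational using (ℚ; 0ℚ; 1ℚ; _+_; _*_; -_; _-_; 1/_; ≢-nonZero)
open import Data.Rational.Properties using (_≟_)
open import Data.Product using (Σ; _×_; ∃; ∃-syntax; _,_)
open import Data.Sum using (_⊎_)
open import Relation.Nullary using (yes; no; ¬_)
open import Relation.Binary.PropositionalEquality using (_≡_; _≢_)

-- squarefree integer: the only natural n with n² ∣ |D| is n = 1
-- (so 0 is not squarefree)
SquareFree : ℤ → Set
SquareFree D = (n : ℕ) → (n ℕ.* n) ℕD.∣ ∣ D ∣ → n ≡ 1

-- D = 1, or D is the discriminant of a quadratic field:
--   D ≡ 1 (mod 4) squarefree, or D = 4m with m ≡ 2,3 (mod 4) squarefree.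
FundamentalDiscriminant : ℤ → Set
FundamentalDiscriminant D =
  (SquareFree D × ∃[ k ] D ≡ ℤ.+ 4 ℤ.* k ℤ.+ ℤ.+ 1)
  ⊎ (∃[ m ] (D ≡ ℤ.+ 4 ℤ.* m × SquareFree m
              × ((∃[ k ] m ≡ ℤ.+ 4 ℤ.* k ℤ.+ ℤ.+ 2)
                 ⊎ (∃[ k ] m ≡ ℤ.+ 4 ℤ.* k ℤ.+ ℤ.+ 3))))

fromℤ : ℤ → ℚ
fromℤ z = Data.Rational._/_ z 1

q : ℕ → ℚ
q n = fromℤ (ℤ.+ n)

sq : ℚ → ℚ
sq x = x * x

cube : ℚ → ℚ
cube x = x * x * x

-- inverse, used only at nonzero arguments (0 ↦ 0 otherwise)
inv : ℚ → ℚ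
inv x with x ≟ 0ℚ
... | yes _ = 0ℚ
... | no x≢0 = 1/_ x {{≢-nonZero x≢0}}

data Point : Set where
  O   : Point
  aff : ℚ → ℚ → Point

record Curve : Set where
  constructor weier
  field a₂ a₄ a₆ : ℚ

OnCurve : Curve → Point → Set
OnCurve E O = ⊤' where open import Data.Unit using () renaming (⊤ to ⊤')
OnCurve (weier a₂ a₄ a₆) (aff x y) =
  sq y ≡ cube x + a₂ * sq x + a₄ * x + a₆

add : Curve → Point → Point → Point
add E O Q = Q
add E P O = P
add (weier a₂ a₄ a₆) (aff x₁ y₁) (aff x₂ y₂) with x₁ ≟ x₂
... | no _ = third ((y₂ - y₁) * inv (x₂ - x₁))
  where
  third : ℚ → Point
  third λ' = let x₃ = sq λ' - a₂ - x₁ - x₂ in aff x₃ (- (λ' * (x₃ - x₁) + y₁))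
... | yes _ with (y₁ + y₂) ≟ 0ℚ
...   | yes _ = O
...   | no _ = third ((q 3 * sq x₁ + q 2 * a₂ * x₁ + a₄) * inv (q 2 * y₁))
  where
  third : ℚ → Point
  third λ' = let x₃ = sq λ' - a₂ - x₁ - x₂ in aff x₃ (- (λ' * (x₃ - x₁) + y₁))

triple : Curve → Point → Point
triple E P = add E P (add E P P)

Order∣3 : Curve → Point → Set
Order∣3 E P = OnCurve E P × triple E P ≡ O

-- the curve  y² = x³ + D(ax+b)²  =  x³ + Da²x² + 2Dab x + Db²
curveE : ℤ → ℚ → ℚ → Curve
curveE D a b = weier (fromℤ D * sq a) (q 2 * fromℤ D * a * b) (fromℤ D * sq b)

xcoord : Point → ℚ → Set
xcoord O _ = Data.Empty.⊥ where import Data.Empty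
xcoord (aff x _) c = x ≡ c

module Submission where

-- An affine point P = (x, y) satisfies 3P = O iff 2y ≠ 0 and x(2P) = x(P), i.e.
-- iff the tangent Y = λX + ν at P is a flex tangent, λ² = a₂ + 3x.  Then
-- f(X) - (λX + ν)² = (X - x)³, and comparing coefficients gives the flex relations
-- for λ and ν.  On E, comparing discriminants of d(aX + b)² - (λX + ν)² and
-- (X - x)³ - X³ yields 4D(aν - λb)² = -3x⁴.  Consequently:
--   * x = 0 makes D a rational square, so D = 1; x ≠ 0 makes -3D a rational
--     square, so D = -3 (fundamental discriminants are squarefree up to 4);
--   * for D = 1 the relation forces x = 0, so P = (0, ±b), and both are flexes;
--   * for D = -3 the relations factor, showing that t = -(±λ + a) is a cube root
--     of 2(9b + 4a³) with 3x = t² + 2at + 4a²; conversely this abscissa is a flex.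

open import Defs
open import Data.Integer as ℤ using (ℤ; +_; -[1+_]; +[1+_])
open import Data.Rational using (ℚ; 0ℚ; 1ℚ; _+_; _*_; -_; _-_; mkℚ; toℚᵘ; Positive; NonNegative; ≢-nonZero)
open import Data.Product using (Σ; _×_; ∃-syntax; _,_; proj₁; proj₂)
open import Data.Sum using (_⊎_; inj₁; inj₂; [_,_]′)
open import Function.Bundles using (_⇔_; mk⇔)
open import Relation.Nullary using (¬_; Dec; yes; no)
open import Relation.Nullary.Decidable using (toWitness)
open import Relation.Binary.PropositionalEquality
open import Data.Empty using (⊥-elim)
open import Data.Unit using (tt)
open import Data.Maybe using (Maybe; just; nothing)

open import Data.Nat as ℕ using (zero; suc)
import Data.Nat.Properties as ℕP
open import Data.Nat.Divisibility as ℕD using (divides)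
open import Data.Nat.DivMod using (_%_; m*n%n≡0)
import Data.Nat.Coprimality as Coprimality
open import Data.Nat.Primality using (Prime; euclidsLemma; prime⇒nonZero; prime?)
import Data.Nat.Tactic.RingSolver as ℕSolver
import Data.Integer.Properties as ℤP
import Data.Integer.Tactic.RingSolver as ℤSolver
import Data.Rational.Properties as ℚP
import Data.Rational.Unnormalised as ℚᵘ
import Data.Rational.Unnormalised.Properties as ℚᵘP
open import Tactic.RingSolver using (solve-∀)
open import Tactic.RingSolver.Core.AlmostCommutativeRing using (AlmostCommutativeRing; fromCommutativeRing)

-- ℚ as a ring for the reflective solver; closed rational constants are
-- evaluated, so numerical facts such as 3 · (1/3) = 1 are absorbed.
ℚ-ring : AlmostCommutativeRing _ _
ℚ-ring = fromCommutativeRing ℚP.+-*-commutativeRing zero?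
  where
  zero? : ∀ x → Maybe (0ℚ ≡ x)
  zero? x with 0ℚ ℚP.≟ x
  ... | yes 0≡x = just 0≡x
  ... | no _    = nothing

inv-inverseˡ : ∀ p → p ≢ 0ℚ → inv p * p ≡ 1ℚ
inv-inverseˡ p p≢0 with p ℚP.≟ 0ℚ
... | yes p≡0 = ⊥-elim (p≢0 p≡0)
... | no  p≢0′ = ℚP.*-inverseˡ p {{≢-nonZero p≢0′}}

inv-inverseʳ : ∀ p → p ≢ 0ℚ → p * inv p ≡ 1ℚ
inv-inverseʳ p p≢0 = trans (ℚP.*-comm p (inv p)) (inv-inverseˡ p p≢0)

zero-product : ∀ p r → p * r ≡ 0ℚ → p ≡ 0ℚ ⊎ r ≡ 0ℚ
zero-product p r pr≡0 with p ℚP.≟ 0ℚ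
... | yes p≡0 = inj₁ p≡0
... | no  p≢0 = inj₂ (begin
  r               ≡⟨ sym (ℚP.*-identityˡ r) ⟩
  1ℚ * r          ≡⟨ cong (_* r) (sym (inv-inverseˡ p p≢0)) ⟩
  inv p * p * r   ≡⟨ ℚP.*-assoc (inv p) p r ⟩
  inv p * (p * r) ≡⟨ cong (inv p *_) pr≡0 ⟩
  inv p * 0ℚ      ≡⟨ ℚP.*-zeroʳ (inv p) ⟩
  0ℚ              ∎)
  where open ≡-Reasoning

cancel-nonzero : ∀ k z → k ≢ 0ℚ → k * z ≡ 0ℚ → z ≡ 0ℚ
cancel-nonzero k z k≢0 kz≡0 with zero-product k z kz≡0
... | inj₁ k≡0 = ⊥-elim (k≢0 k≡0)
... | inj₂ z≡0 = z≡0

square-zero : ∀ p → p * p ≡ 0ℚ → p ≡ 0ℚ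
square-zero p pp≡0 with zero-product p p pp≡0
... | inj₁ p≡0 = p≡0
... | inj₂ p≡0 = p≡0

square-nonNegative : ∀ p → NonNegative (p * p)
square-nonNegative p@(mkℚ (+ _)    _ _) = ℚP.nonNeg*nonNeg⇒nonNeg p p
square-nonNegative p@(mkℚ -[1+ _ ] _ _) = ℚP.pos⇒nonNeg (p * p) {{ℚP.neg*neg⇒pos p p}}

square-positive : ∀ p → p ≢ 0ℚ → Positive (p * p)
square-positive p@(mkℚ (+ zero)  _ _) p≢0 = ⊥-elim (p≢0 (ℚP.↥p≡0⇒p≡0 p refl))
square-positive p@(mkℚ +[1+ _ ]  _ _) _   = ℚP.pos*pos⇒pos p p
square-positive p@(mkℚ -[1+ _ ]  _ _) _   = ℚP.neg*neg⇒pos p p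

positive-definite : ∀ c x y → .{{Positive c}} → x * x + c * (y * y) ≡ 0ℚ → y ≡ 0ℚ
positive-definite c x y form≡0 with y ℚP.≟ 0ℚ
... | yes y≡0 = y≡0
... | no  y≢0 = ⊥-elim (ℚP.<-irrefl refl (ℚP.positive⁻¹ _ {{subst Positive form≡0 form-positive}}))
  where
  instance
    x²-nonNeg = square-nonNegative x
    y²-pos    = square-positive y y≢0
    cy²-pos   = ℚP.pos*pos⇒pos c (y * y)
  form-positive : Positive (x * x + c * (y * y))
  form-positive = ℚP.nonNeg+pos⇒pos (x * x) (c * (y * y))

difference-zero : ∀ {u v} → u ≡ v → u - v ≡ 0ℚ
difference-zero {u} refl = ℚP.+-inverseʳ u

zero-difference : ∀ {u v} → u - v ≡ 0ℚ → u ≡ v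
zero-difference {u} {v} u-v≡0 = begin
  u           ≡⟨ shift u v ⟩
  (u - v) + v ≡⟨ cong (_+ v) u-v≡0 ⟩
  0ℚ + v      ≡⟨ ℚP.+-identityˡ v ⟩
  v           ∎
  where
  open ≡-Reasoning
  shift : ∀ u v → u ≡ (u - v) + v
  shift = solve-∀ ℚ-ring

-- Certificates of polynomial consequences: an equation P = Q follows from
-- hypotheses Uᵢ = Vᵢ once P ≡ Q + Σ cᵢ·(Uᵢ - Vᵢ) is a ring identity; each
-- summand is discarded by the corresponding hypothesis.
discharge : ∀ {R} c {u v} → u ≡ v → R + c * (u - v) ≡ R
discharge {R} c {u} {v} u≡v = begin
  R + c * (u - v) ≡⟨ cong (λ w → R + c * w) (difference-zero u≡v) ⟩
  R + c * 0ℚ      ≡⟨ vanish R c ⟩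
  R               ∎
  where
  open ≡-Reasoning
  vanish : ∀ R c → R + c * 0ℚ ≡ R
  vanish = solve-∀ ℚ-ring

-- Rational cube roots are unique: t³ - s³ = (t - s)(t² + ts + s²), and the
-- second factor is a positive definite form, 4(t² + ts + s²) = (2t + s)² + 3s².
cube-injective : ∀ t s → cube t ≡ cube s → t ≡ s
cube-injective t s t³≡s³ = conclude (zero-product (t - s) (t * t + t * s + s * s) factored)
  where
  factorisation : ∀ t s → (t - s) * (t * t + t * s + s * s) ≡ t * t * t - s * s * s
  factorisation = solve-∀ ℚ-ring
  factored : (t - s) * (t * t + t * s + s * s) ≡ 0ℚ
  factored = trans (factorisation t s) (difference-zero t³≡s³)
  completed : ∀ t s → (q 2 * t + s) * (q 2 * t + s) + q 3 * (s * s) ≡ q 4 * (t * t + t * s + s * s)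
  completed = solve-∀ ℚ-ring
  at-zero : ∀ t → t * t ≡ t * t + t * 0ℚ + 0ℚ * 0ℚ
  at-zero = solve-∀ ℚ-ring
  conclude : t - s ≡ 0ℚ ⊎ t * t + t * s + s * s ≡ 0ℚ → t ≡ s
  conclude (inj₁ t-s≡0)  = zero-difference t-s≡0
  conclude (inj₂ form≡0) = trans t≡0 (sym s≡0)
    where
    s≡0 : s ≡ 0ℚ
    s≡0 = positive-definite (q 3) (q 2 * t + s) s
            (trans (completed t s) (trans (cong (q 4 *_) form≡0) (ℚP.*-zeroʳ (q 4))))
    t≡0 : t ≡ 0ℚ
    t≡0 = square-zero t (trans (subst (λ w → t * t ≡ t * t + t * w + w * w) (sym s≡0) (at-zero t)) form≡0)

-- fromℤ z is the rational z/1 in lowest terms, so it is multiplicative.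
integral : ℤ → ℚ
integral z = mkℚ z 0 (Coprimality.sym (Coprimality.1-coprimeTo ℤ.∣ z ∣))

fromℤ-integral : ∀ z → fromℤ z ≡ integral z
fromℤ-integral z = ℚP.↥p/↧p≡p (integral z)

fromℤ-* : ∀ m n → fromℤ (m ℤ.* n) ≡ fromℤ m * fromℤ n
fromℤ-* m n = sym (cong₂ _*_ (fromℤ-integral m) (fromℤ-integral n))

-- An integer that is the square of a rational is the square of an integer:
-- if n = (u/d)² in lowest terms then d divides u², hence d = 1.
rational-square : ∀ n r → fromℤ n ≡ r * r → ∃[ m ] n ≡ m ℤ.* m
rational-square n r@(mkℚ u d-1 u⊥d) n≡r² = u , n≡u²
  where
  open ≡-Reasoning
  d = suc d-1
  cross-multiplied : n ℤ.* + (d ℕ.* d) ≡ u ℤ.* u ℤ.* + 1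
  cross-multiplied with ℚᵘP.≃-trans (ℚᵘP.≃-reflexive (cong toℚᵘ (trans (sym (fromℤ-integral n)) n≡r²)))
                                    (ℚP.toℚᵘ-homo-* r r)
  ... | ℚᵘ.*≡* eq = eq
  d∣u² : d ℕD.∣ ℤ.∣ u ∣ ℕ.* ℤ.∣ u ∣
  d∣u² = divides (ℤ.∣ n ∣ ℕ.* d) (begin
    ℤ.∣ u ∣ ℕ.* ℤ.∣ u ∣         ≡⟨ ℤP.abs-* u u ⟨
    ℤ.∣ u ℤ.* u ∣               ≡⟨ cong ℤ.∣_∣ (ℤP.*-identityʳ (u ℤ.* u)) ⟨
    ℤ.∣ u ℤ.* u ℤ.* + 1 ∣       ≡⟨ cong ℤ.∣_∣ cross-multiplied ⟨
    ℤ.∣ n ℤ.* + (d ℕ.* d) ∣     ≡⟨ ℤP.abs-* n (+ (d ℕ.* d)) ⟩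
    ℤ.∣ n ∣ ℕ.* (d ℕ.* d)       ≡⟨ ℕP.*-assoc ℤ.∣ n ∣ d d ⟨
    ℤ.∣ n ∣ ℕ.* d ℕ.* d         ∎)
  d⊥u : Coprimality.Coprime d ℤ.∣ u ∣
  d⊥u = Coprimality.sym (Coprimality.recompute u⊥d)
  d≡1 : d ≡ 1
  d≡1 = d⊥u (ℕD.∣-refl , Coprimality.coprime-divisor d⊥u d∣u²)
  n≡u² : n ≡ u ℤ.* u
  n≡u² = begin
    n                       ≡⟨ ℤP.*-identityʳ n ⟨
    n ℤ.* + 1               ≡⟨ cong (λ e → n ℤ.* + (e ℕ.* e)) d≡1 ⟨
    n ℤ.* + (d ℕ.* d)       ≡⟨ cross-multiplied ⟩
    u ℤ.* u ℤ.* + 1         ≡⟨ ℤP.*-identityʳ (u ℤ.* u) ⟩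
    u ℤ.* u                 ∎

squarefree-square : ∀ n m → SquareFree n → n ≡ m ℤ.* m → n ≡ + 1
squarefree-square n m n-sqfree n≡m² = unit-square m ∣m∣≡1 n≡m²
  where
  ∣m∣≡1 : ℤ.∣ m ∣ ≡ 1
  ∣m∣≡1 = n-sqfree ℤ.∣ m ∣ (divides 1 (begin
    ℤ.∣ n ∣               ≡⟨ cong ℤ.∣_∣ n≡m² ⟩
    ℤ.∣ m ℤ.* m ∣         ≡⟨ ℤP.abs-* m m ⟩
    ℤ.∣ m ∣ ℕ.* ℤ.∣ m ∣   ≡⟨ ℕP.*-identityˡ _ ⟨
    1 ℕ.* (ℤ.∣ m ∣ ℕ.* ℤ.∣ m ∣) ∎))
    where open ≡-Reasoning
  unit-square : ∀ m → ℤ.∣ m ∣ ≡ 1 → n ≡ m ℤ.* m → n ≡ + 1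
  unit-square (+ .1)         refl n≡1 = n≡1
  unit-square -[1+ zero ]    _    n≡1 = n≡1

-- If p·|n| is a perfect square for a prime p and a squarefree n, then |n| = p:
-- p divides the root k, say k = jp, so |n| = pj² and j = 1.
prime-times-squarefree : ∀ {p} n k → Prime p → SquareFree n → p ℕ.* ℤ.∣ n ∣ ≡ k ℕ.* k → ℤ.∣ n ∣ ≡ p
prime-times-squarefree {p} n k p-prime n-sqfree pn≡k² = begin
  ℤ.∣ n ∣         ≡⟨ ∣n∣≡pj² ⟩
  p ℕ.* (j ℕ.* j) ≡⟨ cong (λ i → p ℕ.* (i ℕ.* i)) j≡1 ⟩
  p ℕ.* 1         ≡⟨ ℕP.*-identityʳ p ⟩
  p               ∎
  where
  open ≡-Reasoning
  instance _ = prime⇒nonZero p-prime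
  p∣k : p ℕD.∣ k
  p∣k with euclidsLemma k k p-prime (divides ℤ.∣ n ∣ (trans (sym pn≡k²) (ℕP.*-comm p ℤ.∣ n ∣)))
  ... | inj₁ p∣k = p∣k
  ... | inj₂ p∣k = p∣k
  j = ℕD.quotient p∣k
  regroup : ∀ j p → j ℕ.* p ℕ.* (j ℕ.* p) ≡ p ℕ.* (p ℕ.* (j ℕ.* j))
  regroup = ℕSolver.solve-∀
  ∣n∣≡pj² : ℤ.∣ n ∣ ≡ p ℕ.* (j ℕ.* j)
  ∣n∣≡pj² = ℕP.*-cancelˡ-≡ ℤ.∣ n ∣ (p ℕ.* (j ℕ.* j)) p (begin
    p ℕ.* ℤ.∣ n ∣           ≡⟨ pn≡k² ⟩
    k ℕ.* k                 ≡⟨ cong₂ ℕ._*_ (ℕD._∣_.equality p∣k) (ℕD._∣_.equality p∣k) ⟩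
    j ℕ.* p ℕ.* (j ℕ.* p)   ≡⟨ regroup j p ⟩
    p ℕ.* (p ℕ.* (j ℕ.* j)) ∎)
  j≡1 : j ≡ 1
  j≡1 = n-sqfree j (divides p ∣n∣≡pj²)

square-not-negative : ∀ m k → m ℤ.* m ≢ -[1+ k ]
square-not-negative (+ zero) _ ()
square-not-negative +[1+ _ ] _ ()
square-not-negative -[1+ _ ] _ ()

squarefree-minus3-square : ∀ n m → SquareFree n → ℤ.- (+ 3) ℤ.* n ≡ m ℤ.* m → n ≡ ℤ.- (+ 3)
squarefree-minus3-square n m n-sqfree -3n≡m² = by-sign n ∣n∣≡3 -3n≡m²
  where
  ∣n∣≡3 : ℤ.∣ n ∣ ≡ 3
  ∣n∣≡3 = prime-times-squarefree n ℤ.∣ m ∣ (toWitness {a? = prime? 3} tt) n-sqfree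
            (trans (sym (ℤP.abs-* (ℤ.- (+ 3)) n)) (trans (cong ℤ.∣_∣ -3n≡m²) (ℤP.abs-* m m)))
  by-sign : ∀ n → ℤ.∣ n ∣ ≡ 3 → ℤ.- (+ 3) ℤ.* n ≡ m ℤ.* m → n ≡ ℤ.- (+ 3)
  by-sign (+ .3)      refl -9≡m² = ⊥-elim (square-not-negative m 8 (sym -9≡m²))
  by-sign -[1+ .2 ]   refl _     = refl

Residue2or3 : ℤ → Set
Residue2or3 m = (∃[ k ] m ≡ + 4 ℤ.* k ℤ.+ + 2) ⊎ (∃[ k ] m ≡ + 4 ℤ.* k ℤ.+ + 3)

residue-mod-4 : ∀ v k r → v ≡ + 4 ℤ.* k ℤ.+ + r → ℤ.∣ v ℤ.- + r ∣ % 4 ≡ 0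
residue-mod-4 v k r v≡4k+r = begin
  ℤ.∣ v ℤ.- + r ∣ % 4                  ≡⟨ cong (λ w → ℤ.∣ w ℤ.- + r ∣ % 4) v≡4k+r ⟩
  ℤ.∣ + 4 ℤ.* k ℤ.+ + r ℤ.- + r ∣ % 4   ≡⟨ cong (λ w → ℤ.∣ w ∣ % 4) (cancel k (+ r)) ⟩
  ℤ.∣ k ℤ.* + 4 ∣ % 4                  ≡⟨ cong (_% 4) (ℤP.abs-* k (+ 4)) ⟩
  (ℤ.∣ k ∣ ℕ.* 4) % 4                  ≡⟨ m*n%n≡0 ℤ.∣ k ∣ 4 ⟩
  0                                    ∎
  where
  open ≡-Reasoning
  cancel : ∀ k r → + 4 ℤ.* k ℤ.+ r ℤ.- r ≡ k ℤ.* + 4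
  cancel = ℤSolver.solve-∀

-- Integers congruent to 1 modulo 4 (such as 1 and -3) are in neither class;
-- here this is checked by evaluating |c - 2| and |c - 3| modulo 4.
residue-1-mod-4 : ∀ c → ℤ.∣ c ℤ.- + 2 ∣ % 4 ≢ 0 → ℤ.∣ c ℤ.- + 3 ∣ % 4 ≢ 0 → ¬ Residue2or3 c
residue-1-mod-4 c c≢2 c≢3 (inj₁ (k , c≡4k+2)) = c≢2 (residue-mod-4 c k 2 c≡4k+2)
residue-1-mod-4 c c≢2 c≢3 (inj₂ (k , c≡4k+3)) = c≢3 (residue-mod-4 c k 3 c≡4k+3)

-- Let c be an integer outside the classes 2, 3 mod 4 such that every squarefree
-- n with cn a perfect square equals c. Then a fundamental discriminant D with
-- cD a rational square equals c: for D = 4m the same holds for m, forcing m = c.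
fundamental-scaled-square : ∀ c D r → (∀ n m → SquareFree n → c ℤ.* n ≡ m ℤ.* m → n ≡ c) → ¬ Residue2or3 c
  → FundamentalDiscriminant D → fromℤ c * fromℤ D ≡ r * r → D ≡ c
fundamental-scaled-square c D r squarefree-case c-residue (inj₁ (D-sqfree , _)) cD≡r² =
  squarefree-case D root D-sqfree cD≡root²
  where
  open Σ (rational-square (c ℤ.* D) r (trans (fromℤ-* c D) cD≡r²)) renaming (proj₁ to root; proj₂ to cD≡root²)
fundamental-scaled-square c D r squarefree-case c-residue (inj₂ (m , D≡4m , m-sqfree , m-residue)) cD≡r² =
  ⊥-elim (c-residue (subst Residue2or3 m≡c m-residue))
  where
  halve : ∀ c m r → r * r ≡ c * (q 4 * m) → c * m ≡ (r * inv (q 2)) * (r * inv (q 2))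
  halve c m r r²≡4cm = trans (certificate c m r) (discharge (- (inv (q 2) * inv (q 2))) r²≡4cm)
    where
    certificate : ∀ c m r → c * m ≡ (r * inv (q 2)) * (r * inv (q 2)) + (- (inv (q 2) * inv (q 2))) * (r * r - c * (q 4 * m))
    certificate = solve-∀ ℚ-ring
  cm≡[r/2]² : fromℤ (c ℤ.* m) ≡ (r * inv (q 2)) * (r * inv (q 2))
  cm≡[r/2]² = trans (fromℤ-* c m) (halve (fromℤ c) (fromℤ m) r
                (trans (sym cD≡r²) (cong (fromℤ c *_) (trans (cong fromℤ D≡4m) (fromℤ-* (+ 4) m)))))
  open Σ (rational-square (c ℤ.* m) (r * inv (q 2)) cm≡[r/2]²) renaming (proj₁ to root; proj₂ to cm≡root²)
  m≡c : m ≡ c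
  m≡c = squarefree-case m root m-sqfree cm≡root²

module Tangent (a₂ a₄ a₆ x y : ℚ) where
  derivative : ℚ
  derivative = q 3 * sq x + q 2 * a₂ * x + a₄

  slope : ℚ
  slope = derivative * inv (q 2 * y)

  double-x : ℚ
  double-x = sq slope - a₂ - x - x

  intercept : ℚ
  intercept = y - slope * x

affine≢O : ∀ {u v} → aff u v ≢ O
affine≢O ()

-- 3P = O exactly when P is not 2-torsion and 2P has the abscissa of P
-- (then 2P = -P); this unfolds the chord-tangent law.
triple-zero⇒ : ∀ a₂ a₄ a₆ x y → triple (weier a₂ a₄ a₆) (aff x y) ≡ O
  → y + y ≢ 0ℚ × x ≡ Tangent.double-x a₂ a₄ a₆ x y
triple-zero⇒ a₂ a₄ a₆ x y 3P≡O with x ℚP.≟ x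
... | no x≢x = ⊥-elim (x≢x refl)
... | yes _ with (y + y) ℚP.≟ 0ℚ
...   | yes _ = ⊥-elim (affine≢O 3P≡O)
...   | no 2y≢0 with x ℚP.≟ Tangent.double-x a₂ a₄ a₆ x y
...     | no _       = ⊥-elim (affine≢O 3P≡O)
...     | yes x≡x₂P  = 2y≢0 , x≡x₂P

triple-zero⇐ : ∀ a₂ a₄ a₆ x y → y + y ≢ 0ℚ → x ≡ Tangent.double-x a₂ a₄ a₆ x y
  → triple (weier a₂ a₄ a₆) (aff x y) ≡ O
triple-zero⇐ a₂ a₄ a₆ x y 2y≢0 x≡x₂P with x ℚP.≟ x
... | no x≢x = ⊥-elim (x≢x refl)
... | yes _ with (y + y) ℚP.≟ 0ℚ
...   | yes 2y≡0 = ⊥-elim (2y≢0 2y≡0)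
...   | no _ with x ℚP.≟ Tangent.double-x a₂ a₄ a₆ x y
...     | no x≢x₂P = ⊥-elim (x≢x₂P x≡x₂P)
...     | yes _ with (y + - (Tangent.slope a₂ a₄ a₆ x y * (Tangent.double-x a₂ a₄ a₆ x y - x) + y)) ℚP.≟ 0ℚ
...       | yes _ = refl
...       | no y+y₂P≢0 = ⊥-elim (y+y₂P≢0 (subst (λ w → y + - (λ′ * (w - x) + y) ≡ 0ℚ) x≡x₂P (cancels y λ′ x)))
  where
  λ′ = Tangent.slope a₂ a₄ a₆ x y
  cancels : ∀ y l x → y + - (l * (x - x) + y) ≡ 0ℚ
  cancels = solve-∀ ℚ-ring

double-x≡x⇔ : ∀ a₂ a₄ a₆ x y → let open Tangent a₂ a₄ a₆ x y in
  (x ≡ double-x → slope * slope ≡ a₂ + q 3 * x) × (slope * slope ≡ a₂ + q 3 * x → x ≡ double-x)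
double-x≡x⇔ a₂ a₄ a₆ x y =
    (λ x≡x₂P → trans (forward slope a₂ x) (discharge (- 1ℚ) x≡x₂P))
  , (λ λ²≡ → trans (backward slope a₂ x) (discharge (- 1ℚ) λ²≡))
  where
  open Tangent a₂ a₄ a₆ x y
  forward : ∀ l a₂ x → l * l ≡ (a₂ + q 3 * x) + (- 1ℚ) * (x - (l * l - a₂ - x - x))
  forward = solve-∀ ℚ-ring
  backward : ∀ l a₂ x → x ≡ (l * l - a₂ - x - x) + (- 1ℚ) * (l * l - (a₂ + q 3 * x))
  backward = solve-∀ ℚ-ring

-- The flex relations at P: the tangent Y = λX + ν meets the curve with
-- multiplicity three, f(X) - (λX + ν)² = (X - x)³, compared coefficientwise.
record Flex (a₂ a₄ a₆ x y : ℚ) : Set where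
  field
    slope²     : Tangent.slope a₂ a₄ a₆ x y * Tangent.slope a₂ a₄ a₆ x y ≡ a₂ + q 3 * x
    cross      : q 2 * Tangent.slope a₂ a₄ a₆ x y * Tangent.intercept a₂ a₄ a₆ x y ≡ a₄ - q 3 * (x * x)
    intercept² : Tangent.intercept a₂ a₄ a₆ x y * Tangent.intercept a₂ a₄ a₆ x y ≡ x * x * x + a₆

divide-out : ∀ u w → w ≢ 0ℚ → u * inv w * w ≡ u
divide-out u w w≢0 = begin
  u * inv w * w   ≡⟨ ℚP.*-assoc u (inv w) w ⟩
  u * (inv w * w) ≡⟨ cong (u *_) (inv-inverseˡ w w≢0) ⟩
  u * 1ℚ          ≡⟨ ℚP.*-identityʳ u ⟩
  u               ∎
  where open ≡-Reasoning

twice : ∀ y → q 2 * y ≡ y + y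
twice = solve-∀ ℚ-ring

nonzero-double : ∀ y → y ≢ 0ℚ → y + y ≢ 0ℚ
nonzero-double y y≢0 2y≡0 = y≢0 (cancel-nonzero (q 2) y (λ ()) (trans (twice y) 2y≡0))

double-nonzero : ∀ y → y + y ≢ 0ℚ → q 2 * y ≢ 0ℚ
double-nonzero y 2y≢0 2y≡0 = 2y≢0 (trans (sym (twice y)) 2y≡0)

order-three⇒flex : ∀ a₂ a₄ a₆ x y → Order∣3 (weier a₂ a₄ a₆) (aff x y) → Flex a₂ a₄ a₆ x y
order-three⇒flex a₂ a₄ a₆ x y (on-curve , 3P≡O) = record
  { slope²     = slope²
  ; cross      = trans (cross-certificate slope y x a₂ a₄)
                   (trans (discharge (- (q 2 * x)) slope²) (discharge 1ℚ tangent))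
  ; intercept² = trans (intercept-certificate slope y x a₂ a₄ a₆)
                   (trans (discharge (x * x) slope²) (trans (discharge (- x) tangent) (discharge 1ℚ on-curve)))
  }
  where
  open Tangent a₂ a₄ a₆ x y
  2y≢0 : y + y ≢ 0ℚ
  2y≢0 = proj₁ (triple-zero⇒ a₂ a₄ a₆ x y 3P≡O)
  slope² : slope * slope ≡ a₂ + q 3 * x
  slope² = proj₁ (double-x≡x⇔ a₂ a₄ a₆ x y) (proj₂ (triple-zero⇒ a₂ a₄ a₆ x y 3P≡O))
  tangent : slope * (q 2 * y) ≡ derivative
  tangent = divide-out derivative (q 2 * y) (double-nonzero y 2y≢0)
  cross-certificate : ∀ l y x a₂ a₄ → q 2 * l * (y - l * x)
    ≡ (a₄ - q 3 * (x * x)) + 1ℚ * (l * (q 2 * y) - (q 3 * (x * x) + q 2 * a₂ * x + a₄))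
                           + (- (q 2 * x)) * (l * l - (a₂ + q 3 * x))
  cross-certificate = solve-∀ ℚ-ring
  intercept-certificate : ∀ l y x a₂ a₄ a₆ → (y - l * x) * (y - l * x)
    ≡ (x * x * x + a₆) + 1ℚ * (y * y - (x * x * x + a₂ * (x * x) + a₄ * x + a₆))
                       + (- x) * (l * (q 2 * y) - (q 3 * (x * x) + q 2 * a₂ * x + a₄))
                       + (x * x) * (l * l - (a₂ + q 3 * x))
  intercept-certificate = solve-∀ ℚ-ring

quotient-square : ∀ F V c y → y + y ≢ 0ℚ → F * F ≡ q 4 * c * V → y * y ≡ c
  → (F * inv (q 2 * y)) * (F * inv (q 2 * y)) ≡ V
quotient-square F V c y 2y≢0 F²≡4cV y²≡c =
  trans (certificate F V c y (inv (q 2 * y)))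
    (trans (discharge (V * (q 2 * y * inv (q 2 * y) + 1ℚ)) (inv-inverseʳ (q 2 * y) (double-nonzero y 2y≢0)))
      (trans (discharge (- (q 4 * V * (inv (q 2 * y) * inv (q 2 * y)))) y²≡c)
        (discharge (inv (q 2 * y) * inv (q 2 * y)) F²≡4cV)))
  where
  certificate : ∀ F V c y j → (F * j) * (F * j)
    ≡ V + (j * j) * (F * F - q 4 * c * V) + (- (q 4 * V * (j * j))) * (y * y - c)
        + (V * (q 2 * y * j + 1ℚ)) * (q 2 * y * j - 1ℚ)
  certificate = solve-∀ ℚ-ring

flex⇒order-three : ∀ a₂ a₄ a₆ x y → OnCurve (weier a₂ a₄ a₆) (aff x y) → y + y ≢ 0ℚ
  → Tangent.slope a₂ a₄ a₆ x y * Tangent.slope a₂ a₄ a₆ x y ≡ a₂ + q 3 * x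
  → Order∣3 (weier a₂ a₄ a₆) (aff x y)
flex⇒order-three a₂ a₄ a₆ x y on-curve 2y≢0 slope² =
  on-curve , triple-zero⇐ a₂ a₄ a₆ x y 2y≢0 (proj₂ (double-x≡x⇔ a₂ a₄ a₆ x y) slope²)

-- The curve y² = x³ + d(ax + b)² for a rational d; curveE D a b is curve (fromℤ D) a b.
curve : ℚ → ℚ → ℚ → Curve
curve d a b = weier (d * sq a) (q 2 * d * a * b) (d * sq b)

FlexE : ℚ → ℚ → ℚ → ℚ → ℚ → Set
FlexE d a b = Flex (d * sq a) (q 2 * d * a * b) (d * sq b)

on-curve-at-zero : ∀ d a b x y → x ≡ 0ℚ → OnCurve (curve d a b) (aff x y) → y * y ≡ d * (b * b)
on-curve-at-zero d a b .0ℚ y refl on-curve = trans on-curve (at-zero d a b)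
  where
  at-zero : ∀ d a b → 0ℚ * 0ℚ * 0ℚ + d * (a * a) * (0ℚ * 0ℚ) + q 2 * d * a * b * 0ℚ + d * (b * b) ≡ d * (b * b)
  at-zero = solve-∀ ℚ-ring

-- Comparing the discriminants of the two sides of d(aX + b)² - (λX + ν)² = (X - x)³ - X³
-- gives 4d(aν - λb)² = -3x⁴ at a flex.
discriminant-relation : ∀ d a b x y → FlexE d a b x y
  → let open Tangent (d * sq a) (q 2 * d * a * b) (d * sq b) x y in
    q 4 * d * ((a * intercept - slope * b) * (a * intercept - slope * b)) + q 3 * ((x * x) * (x * x)) ≡ 0ℚ
discriminant-relation d a b x y flex =
  trans (certificate d a b slope intercept x)
    (trans (discharge (q 4 * (d * (a * a) - slope * slope)) intercept²)
      (trans (discharge (- (q 2 * d * a * b - q 2 * slope * intercept + q 3 * (x * x))) cross)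
        (discharge (- (q 4 * (x * x * x))) slope²)))
  where
  open Tangent (d * sq a) (q 2 * d * a * b) (d * sq b) x y
  open Flex flex
  certificate : ∀ d a b l n x → q 4 * d * ((a * n - l * b) * (a * n - l * b)) + q 3 * ((x * x) * (x * x))
    ≡ 0ℚ + (- (q 4 * (x * x * x))) * (l * l - (d * (a * a) + q 3 * x))
         + (- (q 2 * d * a * b - q 2 * l * n + q 3 * (x * x))) * (q 2 * l * n - (q 2 * d * a * b - q 3 * (x * x)))
         + (q 4 * (d * (a * a) - l * l)) * (n * n - (x * x * x + d * (b * b)))
  certificate = solve-∀ ℚ-ring

one : ℚ
one = fromℤ (+ 1)

-- The discriminant relation 4s² + 3x⁴ = 0 forces x = 0.
d1-flex-abscissa : ∀ a b x y → FlexE one a b x y → x ≡ 0ℚ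
d1-flex-abscissa a b x y flex =
  square-zero x (positive-definite (q 3) (q 2 * s) (x * x)
    (trans (rescale s x) (discriminant-relation one a b x y flex)))
  where
  open Tangent (one * sq a) (q 2 * one * a * b) (one * sq b) x y
  s = a * intercept - slope * b
  rescale : ∀ s x → (q 2 * s) * (q 2 * s) + q 3 * ((x * x) * (x * x)) ≡ q 4 * one * (s * s) + q 3 * ((x * x) * (x * x))
  rescale = solve-∀ ℚ-ring

-- (0, y) with y² = b² ≠ 0 has order 3: there λ = ab/y and λ² = a².
d1-vertical-point : ∀ a b y → y ≢ 0ℚ → y * y ≡ b * b → Order∣3 (curve one a b) (aff 0ℚ y)
d1-vertical-point a b y y≢0 y²≡b² =
  flex⇒order-three a₂ a₄ a₆ 0ℚ y on-curve 2y≢0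
    (quotient-square (Tangent.derivative a₂ a₄ a₆ 0ℚ y) (a₂ + q 3 * 0ℚ) (b * b) y 2y≢0 (derivative² a b) y²≡b²)
  where
  a₂ = one * sq a
  a₄ = q 2 * one * a * b
  a₆ = one * sq b
  2y≢0 = nonzero-double y y≢0
  at-zero : ∀ a b → b * b ≡ 0ℚ * 0ℚ * 0ℚ + one * (a * a) * (0ℚ * 0ℚ) + q 2 * one * a * b * 0ℚ + one * (b * b)
  at-zero = solve-∀ ℚ-ring
  on-curve : OnCurve (curve one a b) (aff 0ℚ y)
  on-curve = trans y²≡b² (at-zero a b)
  derivative² : ∀ a b → (q 3 * (0ℚ * 0ℚ) + q 2 * (one * (a * a)) * 0ℚ + q 2 * one * a * b)
                      * (q 3 * (0ℚ * 0ℚ) + q 2 * (one * (a * a)) * 0ℚ + q 2 * one * a * b)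
                      ≡ q 4 * (b * b) * (one * (a * a) + q 3 * 0ℚ)
  derivative² = solve-∀ ℚ-ring

d1-order-three : ∀ a b → b ≢ 0ℚ → (P : Point)
  → Order∣3 (curve one a b) P ⇔ (P ≡ O ⊎ P ≡ aff 0ℚ b ⊎ P ≡ aff 0ℚ (- b))
d1-order-three a b b≢0 P = mk⇔ (classify P) realise
  where
  classify : ∀ P → Order∣3 (curve one a b) P → P ≡ O ⊎ P ≡ aff 0ℚ b ⊎ P ≡ aff 0ℚ (- b)
  classify O _ = inj₁ refl
  classify (aff x y) order-three@(on-curve , _) = sign (zero-product (y - b) (y + b) (trans (difference-of-squares y b) (difference-zero y²≡b²)))
    where
    x≡0 : x ≡ 0ℚ
    x≡0 = d1-flex-abscissa a b x y (order-three⇒flex _ _ _ x y order-three)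
    y²≡b² : y * y ≡ b * b
    y²≡b² = trans (on-curve-at-zero one a b x y x≡0 on-curve) (ℚP.*-identityˡ (b * b))
    difference-of-squares : ∀ y b → (y - b) * (y + b) ≡ y * y - b * b
    difference-of-squares = solve-∀ ℚ-ring
    negate : ∀ y b → y ≡ (y + b) - b
    negate = solve-∀ ℚ-ring
    sign : y - b ≡ 0ℚ ⊎ y + b ≡ 0ℚ → aff x y ≡ O ⊎ aff x y ≡ aff 0ℚ b ⊎ aff x y ≡ aff 0ℚ (- b)
    sign (inj₁ y-b≡0) = inj₂ (inj₁ (cong₂ aff x≡0 (zero-difference y-b≡0)))
    sign (inj₂ y+b≡0) = inj₂ (inj₂ (cong₂ aff x≡0 (trans (negate y b) (trans (cong (_- b) y+b≡0) (ℚP.+-identityˡ (- b))))))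
  realise : P ≡ O ⊎ P ≡ aff 0ℚ b ⊎ P ≡ aff 0ℚ (- b) → Order∣3 (curve one a b) P
  realise (inj₁ refl)        = _ , refl
  realise (inj₂ (inj₁ refl)) = d1-vertical-point a b b b≢0 refl
  realise (inj₂ (inj₂ refl)) = d1-vertical-point a b (- b) (λ -b≡0 → b≢0 (ℚP.neg-injective -b≡0)) (square-neg b)
    where
    square-neg : ∀ b → (- b) * (- b) ≡ b * b
    square-neg = solve-∀ ℚ-ring

minus-three : ℚ
minus-three = fromℤ (ℤ.- ℤ.+ 3)

-- The quantity 2(9b + 4a³) whose cube root governs the 3-torsion, and the
-- norm form N(t, a) = t² + 2at + 4a² = (t + a)² + 3a² of ℚ(√-3).
radicand : ℚ → ℚ → ℚ
radicand a b = q 2 * (q 9 * b + q 4 * cube a)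

norm-form : ℚ → ℚ → ℚ
norm-form t a = t * t + q 2 * a * t + q 4 * (a * a)

norm-form-definite : ∀ t a → norm-form t a ≡ 0ℚ → t ≡ 0ℚ
norm-form-definite t a N≡0 = square-zero t (trans t²≡N N≡0)
  where
  completed : ∀ t a → (t + a) * (t + a) + q 3 * (a * a) ≡ t * t + q 2 * a * t + q 4 * (a * a)
  completed = solve-∀ ℚ-ring
  a≡0 : a ≡ 0ℚ
  a≡0 = positive-definite (q 3) (t + a) a (trans (completed t a) N≡0)
  drop-a : ∀ t → t * t ≡ t * t + q 2 * 0ℚ * t + q 4 * (0ℚ * 0ℚ)
  drop-a = solve-∀ ℚ-ring
  t²≡N : t * t ≡ norm-form t a
  t²≡N = subst (λ a → t * t ≡ norm-form t a) (sym a≡0) (drop-a t)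

cube-root-from-factor : ∀ a b x l → l * l ≡ minus-three * (a * a) + q 3 * x → q 6 * b + x * (l + q 3 * a) ≡ 0ℚ
  → cube (- (l + a)) ≡ radicand a b × q 3 * x ≡ norm-form (- (l + a)) a
cube-root-from-factor a b x l l² factor≡0 =
    trans (cube-certificate a b x l) (trans (discharge (- (l + q 3 * a)) l²) (discharge (- q 3) factor≡0))
  , trans (norm-certificate a x l) (discharge (- 1ℚ) l²)
  where
  cube-certificate : ∀ a b x l → (- (l + a)) * (- (l + a)) * (- (l + a))
    ≡ q 2 * (q 9 * b + q 4 * (a * a * a)) + (- q 3) * ((q 6 * b + x * (l + q 3 * a)) - 0ℚ)
        + (- (l + q 3 * a)) * (l * l - (minus-three * (a * a) + q 3 * x))
  cube-certificate = solve-∀ ℚ-ring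
  norm-certificate : ∀ a x l → q 3 * x
    ≡ ((- (l + a)) * (- (l + a)) + q 2 * a * (- (l + a)) + q 4 * (a * a))
        + (- 1ℚ) * (l * l - (minus-three * (a * a) + q 3 * x))
  norm-certificate = solve-∀ ℚ-ring

minus3-cube-root : ∀ a b x y → b ≢ 0ℚ → Order∣3 (curve minus-three a b) (aff x y)
  → ∃[ t ] (cube t ≡ radicand a b × q 3 * x ≡ norm-form t a)
minus3-cube-root a b x y b≢0 order-three@(on-curve , _) = from-factor (zero-product f₊ f₋ f₊f₋≡0)
  where
  flex = order-three⇒flex _ _ _ x y order-three
  open Tangent (minus-three * sq a) (q 2 * minus-three * a * b) (minus-three * sq b) x y
  open Flex flex
  f₊ = q 6 * b + x * (slope + q 3 * a)
  f₋ = q 6 * b + x * (- slope + q 3 * a)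
  -- x = 0 would give y² + 3b² = 0
  x≢0 : x ≢ 0ℚ
  x≢0 x≡0 = b≢0 (positive-definite (q 3) y b (trans (cong (_+ q 3 * (b * b)) (on-curve-at-zero minus-three a b x y x≡0 on-curve)) (cancels b)))
    where
    cancels : ∀ b → minus-three * (b * b) + q 3 * (b * b) ≡ 0ℚ
    cancels = solve-∀ ℚ-ring
  certificate : ∀ a b l n x → x * ((q 6 * b + x * (l + q 3 * a)) * (q 6 * b + x * (- l + q 3 * a)))
    ≡ 0ℚ + (- (x * x * x) + q 4 * (n * n)) * (l * l - (minus-three * (a * a) + q 3 * x))
         + (- (q 2 * l * n + (q 2 * minus-three * a * b - q 3 * (x * x)))) * (q 2 * l * n - (q 2 * minus-three * a * b - q 3 * (x * x)))
         + (q 4 * (minus-three * (a * a) + q 3 * x)) * (n * n - (x * x * x + minus-three * (b * b)))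
  certificate = solve-∀ ℚ-ring
  f₊f₋≡0 : f₊ * f₋ ≡ 0ℚ
  f₊f₋≡0 = cancel-nonzero x (f₊ * f₋) x≢0
    (trans (certificate a b slope intercept x)
      (trans (discharge (q 4 * (minus-three * (a * a) + q 3 * x)) intercept²)
        (trans (discharge (- (q 2 * slope * intercept + (q 2 * minus-three * a * b - q 3 * (x * x)))) cross)
          (discharge (- (x * x * x) + q 4 * (intercept * intercept)) slope²))))
  negated : ∀ l → (- l) * (- l) ≡ l * l
  negated = solve-∀ ℚ-ring
  from-factor : f₊ ≡ 0ℚ ⊎ f₋ ≡ 0ℚ → ∃[ t ] (cube t ≡ radicand a b × q 3 * x ≡ norm-form t a)
  from-factor (inj₁ f₊≡0) = - (slope + a) , cube-root-from-factor a b x slope slope² f₊≡0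
  from-factor (inj₂ f₋≡0) = - (- slope + a) , cube-root-from-factor a b x (- slope) (trans (negated slope) slope²) f₋≡0

solve-b : ∀ a b t → radicand a b ≡ cube t → b ≡ (t * t * t - q 8 * (a * a * a)) * inv (q 18)
solve-b a b t W≡t³ = trans (certificate a b t) (discharge (inv (q 18)) W≡t³)
  where
  certificate : ∀ a b t → b ≡ (t * t * t - q 8 * (a * a * a)) * inv (q 18)
                              + inv (q 18) * (q 2 * (q 9 * b + q 4 * (a * a * a)) - t * t * t)
  certificate = solve-∀ ℚ-ring

stated-abscissa : ℚ → ℚ → ℚ → ℚ
stated-abscissa a b t = sq t * inv (q 3) + q 3 * inv (sq t) * (q 4 * a * b + q 16 * inv (q 9) * sq (sq a)) + q 4 * sq a * inv (q 3)

stated-abscissa≡norm/3 : ∀ a b t → t ≢ 0ℚ → b ≡ (t * t * t - q 8 * (a * a * a)) * inv (q 18)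
  → stated-abscissa a b t ≡ norm-form t a * inv (q 3)
stated-abscissa≡norm/3 a b t t≢0 refl =
  trans (certificate a t (inv (t * t)))
    (discharge (q 2 * inv (q 3) * a * t) (inv-inverseʳ (t * t) (λ t²≡0 → t≢0 (square-zero t t²≡0))))
  where
  certificate : ∀ a t i →
    let b = (t * t * t - q 8 * (a * a * a)) * inv (q 18)
    in t * t * inv (q 3) + q 3 * i * (q 4 * a * b + q 16 * inv (q 9) * ((a * a) * (a * a))) + q 4 * (a * a) * inv (q 3)
       ≡ (t * t + q 2 * a * t + q 4 * (a * a)) * inv (q 3) + (q 2 * inv (q 3) * a * t) * (t * t * i - 1ℚ)
  certificate = solve-∀ ℚ-ring

-- Substituting x = N(t, a)/3 and b = (t³ - 8a³)/18 into y² = f(x) = x³ - 3(ax + b)²,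
-- 4f(x) = (xt)² and f'(x)² = 4f(x)(-3a² + 3x) become polynomial identities in a and t.
four-cubic : ∀ a t →
  let x = (t * t + q 2 * a * t + q 4 * (a * a)) * inv (q 3)
      b = (t * t * t - q 8 * (a * a * a)) * inv (q 18)
  in q 4 * (x * x * x + minus-three * (a * a) * (x * x) + q 2 * minus-three * a * b * x + minus-three * (b * b))
     ≡ (x * t) * (x * t)
four-cubic = solve-∀ ℚ-ring

derivative-identity : ∀ a t →
  let x = (t * t + q 2 * a * t + q 4 * (a * a)) * inv (q 3)
      b = (t * t * t - q 8 * (a * a * a)) * inv (q 18)
      F = q 3 * (x * x) + q 2 * (minus-three * (a * a)) * x + q 2 * minus-three * a * b
  in F * F ≡ q 4 * (x * x * x + minus-three * (a * a) * (x * x) + q 2 * minus-three * a * b * x + minus-three * (b * b))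
                 * (minus-three * (a * a) + q 3 * x)
derivative-identity = solve-∀ ℚ-ring

-- Conversely, with b = (t³ - 8a³)/18 and t ≠ 0, a point of y² = x³ - 3(ax + b)²
-- with x = N(t, a)/3 has order 3: by the identities above (2y)² = (xt)² ≠ 0,
-- and λ² = f'(x)²/4y² = a₂ + 3x.
minus3-flex-point : ∀ a b t x y → t ≢ 0ℚ → b ≡ (t * t * t - q 8 * (a * a * a)) * inv (q 18)
  → x ≡ norm-form t a * inv (q 3) → OnCurve (curve minus-three a b) (aff x y)
  → Order∣3 (curve minus-three a b) (aff x y)
minus3-flex-point a b t x y t≢0 refl refl on-curve =
  flex⇒order-three _ _ _ x y on-curve 2y≢0
    (quotient-square (Tangent.derivative a₂ a₄ a₆ x y) (a₂ + q 3 * x) f y 2y≢0 (derivative-identity a t) on-curve)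
  where
  a₂ = minus-three * sq a
  a₄ = q 2 * minus-three * a * b
  a₆ = minus-three * sq b
  f = cube x + a₂ * sq x + a₄ * x + a₆
  quadruple : ∀ y → (y + y) * (y + y) ≡ q 4 * (y * y)
  quadruple = solve-∀ ℚ-ring
  x≢0 : x ≢ 0ℚ
  x≢0 x≡0 = [ (λ N≡0 → t≢0 (norm-form-definite t a N≡0)) , (λ ()) ]′
              (zero-product (norm-form t a) (inv (q 3)) x≡0)
  xt²≡0 : y + y ≡ 0ℚ → (x * t) * (x * t) ≡ 0ℚ
  xt²≡0 2y≡0 = begin
    (x * t) * (x * t)   ≡⟨ four-cubic a t ⟨
    q 4 * f             ≡⟨ cong (q 4 *_) on-curve ⟨
    q 4 * (y * y)       ≡⟨ quadruple y ⟨
    (y + y) * (y + y)   ≡⟨ cong (λ w → w * w) 2y≡0 ⟩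
    0ℚ * 0ℚ             ≡⟨⟩
    0ℚ                  ∎
    where open ≡-Reasoning
  2y≢0 : y + y ≢ 0ℚ
  2y≢0 2y≡0 = [ x≢0 , t≢0 ]′ (zero-product x t (square-zero (x * t) (xt²≡0 2y≡0)))

minus3-order-three : ∀ a b t → b ≢ 0ℚ → t ≢ 0ℚ → radicand a b ≡ cube t → (P : Point)
  → Order∣3 (curve minus-three a b) P ⇔ (P ≡ O ⊎ (OnCurve (curve minus-three a b) P × xcoord P (stated-abscissa a b t)))
minus3-order-three a b t b≢0 t≢0 W≡t³ P = mk⇔ (classify P) (realise P)
  where
  b≡B : b ≡ (t * t * t - q 8 * (a * a * a)) * inv (q 18)
  b≡B = solve-b a b t W≡t³
  X≡N/3 : stated-abscissa a b t ≡ norm-form t a * inv (q 3)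
  X≡N/3 = stated-abscissa≡norm/3 a b t t≢0 b≡B
  thirds : ∀ x → x ≡ q 3 * x * inv (q 3)
  thirds = solve-∀ ℚ-ring
  classify : ∀ P → Order∣3 (curve minus-three a b) P
    → P ≡ O ⊎ (OnCurve (curve minus-three a b) P × xcoord P (stated-abscissa a b t))
  classify O _ = inj₁ refl
  classify (aff x y) order-three@(on-curve , _) = inj₂ (on-curve , trans x≡N/3 (sym X≡N/3))
    where
    open Σ (minus3-cube-root a b x y b≢0 order-three) renaming (proj₁ to t₀; proj₂ to root)
    t₀≡t : t₀ ≡ t
    t₀≡t = cube-injective t₀ t (trans (proj₁ root) W≡t³)
    x≡N/3 : x ≡ norm-form t a * inv (q 3)
    x≡N/3 = trans (thirds x) (cong (_* inv (q 3)) (trans (proj₂ root) (cong (λ s → norm-form s a) t₀≡t)))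
  realise : ∀ P → P ≡ O ⊎ (OnCurve (curve minus-three a b) P × xcoord P (stated-abscissa a b t))
    → Order∣3 (curve minus-three a b) P
  realise O         (inj₁ refl)            = _ , refl
  realise O         (inj₂ (_ , ()))
  realise (aff x y) (inj₂ (on-curve , x≡X)) = minus3-flex-point a b t x y t≢0 b≡B (trans x≡X X≡N/3) on-curve

square-ratio : ∀ d b y → b ≢ 0ℚ → y * y ≡ d * (b * b) → d ≡ (y * inv b) * (y * inv b)
square-ratio d b y b≢0 y²≡db² =
  sym (trans (certificate d b y (inv b))
        (trans (discharge (d * (b * inv b + 1ℚ)) (inv-inverseʳ b b≢0))
          (discharge (inv b * inv b) y²≡db²)))
  where
  certificate : ∀ d b y i → (y * i) * (y * i)
    ≡ d + (i * i) * (y * y - d * (b * b)) + (d * (b * i + 1ℚ)) * (b * i - 1ℚ)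
  certificate = solve-∀ ℚ-ring

minus3-times-square : ∀ d s X → s ≢ 0ℚ → q 4 * d * (s * s) + q 3 * (X * X) ≡ 0ℚ
  → minus-three * d ≡ (q 3 * X * inv (q 2 * s)) * (q 3 * X * inv (q 2 * s))
minus3-times-square d s X s≢0 relation =
  sym (trans (certificate d s X (inv (q 2 * s)))
        (trans (discharge (minus-three * d * (q 2 * s * inv (q 2 * s) + 1ℚ)) (inv-inverseʳ (q 2 * s) 2s≢0))
          (discharge (q 3 * (inv (q 2 * s) * inv (q 2 * s))) relation)))
  where
  2s≢0 : q 2 * s ≢ 0ℚ
  2s≢0 2s≡0 = s≢0 (cancel-nonzero (q 2) s (λ ()) 2s≡0)
  certificate : ∀ d s X j → (q 3 * X * j) * (q 3 * X * j)
    ≡ minus-three * d + (q 3 * (j * j)) * ((q 4 * d * (s * s) + q 3 * (X * X)) - 0ℚ)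
        + (minus-three * d * (q 2 * s * j + 1ℚ)) * (q 2 * s * j - 1ℚ)
  certificate = solve-∀ ℚ-ring

-- A fundamental discriminant D for which y² = x³ + D(ax + b)², b ≠ 0, has an
-- affine point of order 3 is 1 (when x = 0, D is a square) or -3 (when x ≠ 0,
-- -3D is a square by the discriminant relation).
torsion-discriminant : ∀ D a b x y → FundamentalDiscriminant D → b ≢ 0ℚ
  → Order∣3 (curveE D a b) (aff x y) → D ≡ ℤ.+ 1 ⊎ D ≡ ℤ.- ℤ.+ 3
torsion-discriminant D a b x y fd b≢0 order-three@(on-curve , _) = by-abscissa (x ℚP.≟ 0ℚ)
  where
  d = fromℤ D
  open Tangent (d * sq a) (q 2 * d * a * b) (d * sq b) x y
  s = a * intercept - slope * b
  relation : q 4 * d * (s * s) + q 3 * ((x * x) * (x * x)) ≡ 0ℚ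
  relation = discriminant-relation d a b x y (order-three⇒flex _ _ _ x y order-three)
  drop-s : ∀ d X → q 4 * d * (0ℚ * 0ℚ) + q 3 * X ≡ q 3 * X
  drop-s = solve-∀ ℚ-ring
  s≢0 : x ≢ 0ℚ → s ≢ 0ℚ
  s≢0 x≢0 s≡0 = x≢0 (square-zero x (square-zero (x * x) (cancel-nonzero (q 3) ((x * x) * (x * x)) (λ ()) 3x⁴≡0)))
    where
    3x⁴≡0 : q 3 * ((x * x) * (x * x)) ≡ 0ℚ
    3x⁴≡0 = trans (sym (drop-s d ((x * x) * (x * x))))
                  (subst (λ s → q 4 * d * (s * s) + q 3 * ((x * x) * (x * x)) ≡ 0ℚ) s≡0 relation)
  by-abscissa : Dec (x ≡ 0ℚ) → D ≡ ℤ.+ 1 ⊎ D ≡ ℤ.- ℤ.+ 3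
  by-abscissa (yes x≡0) = inj₁ (fundamental-scaled-square (+ 1) D (y * inv b) unit-case (residue-1-mod-4 (+ 1) (λ ()) (λ ())) fd
    (trans (ℚP.*-identityˡ d) (square-ratio d b y b≢0 (on-curve-at-zero d a b x y x≡0 on-curve))))
    where
    unit-case : ∀ n m → SquareFree n → + 1 ℤ.* n ≡ m ℤ.* m → n ≡ + 1
    unit-case n m n-sqfree n≡m² = squarefree-square n m n-sqfree (trans (sym (ℤP.*-identityˡ n)) n≡m²)
  by-abscissa (no x≢0) = inj₂ (fundamental-scaled-square (ℤ.- ℤ.+ 3) D (q 3 * (x * x) * inv (q 2 * s)) squarefree-minus3-square
    (residue-1-mod-4 (ℤ.- ℤ.+ 3) (λ ()) (λ ())) fd (minus3-times-square d s (x * x) (s≢0 x≢0) relation))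

-- For D = -3, a point of order 3 yields a nonzero cube root of 2(9b + 4a³);
-- it is nonzero because 4Da³ - 27b = -(3/2)·2(9b + 4a³) ≠ 0.
minus3-nonzero-root : ∀ D a b x y → D ≡ ℤ.- ℤ.+ 3 → b ≢ 0ℚ → q 4 * fromℤ D * cube a - q 27 * b ≢ 0ℚ
  → Order∣3 (curveE D a b) (aff x y) → ∃[ t ] (t ≢ 0ℚ × radicand a b ≡ cube t)
minus3-nonzero-root .(ℤ.- ℤ.+ 3) a b x y refl b≢0 disc≢0 order-three =
  t , t≢0 , sym (proj₁ root)
  where
  open Σ (minus3-cube-root a b x y b≢0 order-three) renaming (proj₁ to t; proj₂ to root)
  proportional : ∀ a b → q 4 * minus-three * (a * a * a) - q 27 * b
                          ≡ (- (q 3 * inv (q 2))) * (q 2 * (q 9 * b + q 4 * (a * a * a)))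
  proportional = solve-∀ ℚ-ring
  t≢0 : t ≢ 0ℚ
  t≢0 t≡0 = disc≢0 (begin
    q 4 * minus-three * cube a - q 27 * b      ≡⟨ proportional a b ⟩
    (- (q 3 * inv (q 2))) * radicand a b       ≡⟨ cong (- (q 3 * inv (q 2)) *_) (trans (sym (proj₁ root)) (cong cube t≡0)) ⟩
    (- (q 3 * inv (q 2))) * 0ℚ                 ≡⟨ ℚP.*-zeroʳ (- (q 3 * inv (q 2))) ⟩
    0ℚ                                         ∎)
    where open ≡-Reasoning

no-other-torsion : ∀ D a b → FundamentalDiscriminant D → b ≢ 0ℚ → q 4 * fromℤ D * cube a - q 27 * b ≢ 0ℚ
  → D ≢ ℤ.+ 1 → ¬ (D ≡ ℤ.- ℤ.+ 3 × ∃[ t ] (t ≢ 0ℚ × radicand a b ≡ cube t))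
  → (P : Point) → Order∣3 (curveE D a b) P ⇔ P ≡ O
no-other-torsion D a b fd b≢0 disc≢0 D≢1 no-root P = mk⇔ (only-O P) (λ { refl → _ , refl })
  where
  only-O : ∀ P → Order∣3 (curveE D a b) P → P ≡ O
  only-O O         _           = refl
  only-O (aff x y) order-three =
    ⊥-elim ([ D≢1 , (λ D≡-3 → no-root (D≡-3 , minus3-nonzero-root D a b x y D≡-3 b≢0 disc≢0 order-three)) ]′
              (torsion-discriminant D a b x y fd b≢0 order-three))

lemma2p1 : (D : ℤ) (a b : ℚ) → FundamentalDiscriminant D → b ≢ 0ℚ
    → q 4 * fromℤ D * cube a - q 27 * b ≢ 0ℚ
    → (D ≡ ℤ.+ 1 → (P : Point)
          → Order∣3 (curveE D a b) P ⇔ (P ≡ O ⊎ P ≡ aff 0ℚ b ⊎ P ≡ aff 0ℚ (- b)))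
    × (D ≡ ℤ.- ℤ.+ 3 → (t : ℚ) → t ≢ 0ℚ → q 2 * (q 9 * b + q 4 * cube a) ≡ cube t
        → (P : Point)
        → Order∣3 (curveE D a b) P
            ⇔ (P ≡ O ⊎ (OnCurve (curveE D a b) P
                  × xcoord P (sq t * inv (q 3)
                              + q 3 * inv (sq t) * (q 4 * a * b + q 16 * inv (q 9) * sq (sq a))
                              + q 4 * sq a * inv (q 3)))))
    × (D ≢ ℤ.+ 1
        → ¬ (D ≡ ℤ.- ℤ.+ 3 × ∃[ t ] (t ≢ 0ℚ × q 2 * (q 9 * b + q 4 * cube a) ≡ cube t))
        → (P : Point) → Order∣3 (curveE D a b) P ⇔ P ≡ O)
lemma2p1 D a b fd b≢0 disc≢0 =
    (λ { refl → d1-order-three a b b≢0 })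
  , (λ { refl t t≢0 W≡t³ → minus3-order-three a b t b≢0 t≢0 W≡t³ })
  , no-other-torsion D a b fd b≢0 disc≢0
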